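{- Let $k$ be a nonnegative integer and let $G$ be a connected graph with $\Delta(G)\geq k+2$. Then \[Z_k(G)\leq \left\lfloor \frac{|G|}{k+2}\,(\Delta(G)+1-k)\right\rfloor,\] and this bound is tight (attained with equality by some such graph).
   Context: Graphs are finite, simple and undirected; $|G|$ is the number of vertices and $\Delta(G)$ the maximum degree. For a graph $G=(V,E)$, nonnegative integer $k$ and $T\subseteq V$, $\mathscr F^0_{G,k}(T)=T$, $\mathscr F^{i+1}_{G,k}(T)=\mathscr F^i_{G,k}(T)\cup\bigcup\{N(v): v\in \mathscr F^i_{G,k}(T),\ 1\le |N(v)\setminus \mathscr F^i_{G,k}(T)|\le k\}$; $T$ is a $k$-forcing set if $\mathscr F^t_{G,k}(T)=V$ for some $t$, and $Z_k(G)$ is the minimum size of a $k$-forcing set. -}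

module Defs where

open import Data.Nat using (ℕ; zero; suc; _+_; _*_; _∸_; _≤_; _⊔_)
open import Data.Nat.DivMod using (_/_)
open import Data.Bool using (Bool; true; false; _∧_; _∨_; not; if_then_else_)
open import Data.Fin using (Fin)
open import Data.List using (List; []; _∷_; allFin; map; foldr)
open import Data.Nat.ListAction using (sum)
open import Data.Bool.ListAction using (any)
open import Data.Product using (Σ; ∃; _×_; _,_)
open import Relation.Binary.PropositionalEquality using (_≡_)

record Graph : Set where
  field
    n      : ℕ
    adj    : Fin n → Fin n → Bool
    sym    : ∀ u v → adj u v ≡ adj v u
    irrefl : ∀ v → adj v v ≡ false
open Graph public

order : Graph → ℕ
order G = n G

VSet : Graph → Set
VSet G = Fin (n G) → Bool

count : ∀ {m} → (Fin m → Bool) → ℕ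
count {m} p = sum (map (λ i → if p i then 1 else 0) (allFin m))

∣_∣ : ∀ {G} → VSet G → ℕ
∣ T ∣ = count T

degree : (G : Graph) → Fin (n G) → ℕ
degree G v = count (adj G v)

-- Δ(G) (0 for the empty graph)
maxDegree : Graph → ℕ
maxDegree G = foldr (λ v m → degree G v ⊔ m) 0 (allFin (n G))

data Walk (G : Graph) : Fin (n G) → Fin (n G) → Set where
  here : ∀ {v} → Walk G v v
  step : ∀ {u v w} → adj G u v ≡ true → Walk G v w → Walk G u w

Connected : Graph → Set
Connected G = ∀ u v → Walk G u v

outside : (G : Graph) → VSet G → Fin (n G) → ℕ
outside G F v = count (λ w → adj G v w ∧ not (F w))

-- v may force: v ∈ F and 1 ≤ |N(v) \ F| ≤ k
active : (G : Graph) → ℕ → VSet G → Fin (n G) → Bool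
active G k F v with outside G F v
... | zero = false
... | suc m = F v ∧ (Data.Nat._≤ᵇ_ (suc m) k)

forceStep : (G : Graph) → ℕ → VSet G → VSet G
forceStep G k F w = F w ∨ any (λ v → active G k F v ∧ adj G v w) (allFin (n G))

closure : (G : Graph) → ℕ → VSet G → ℕ → VSet G
closure G k T zero = T
closure G k T (suc t) = forceStep G k (closure G k T t)

IsForcingSet : (G : Graph) → ℕ → VSet G → Set
IsForcingSet G k T = ∃ λ t → ∀ w → closure G k T t w ≡ true

IsZk : (G : Graph) → ℕ → ℕ → Set
IsZk G k m = (Σ (VSet G) λ T → IsForcingSet G k T × ∣_∣ {G} T ≡ m)
           × (∀ T → IsForcingSet G k T → m ≤ ∣_∣ {G} T)

bound : Graph → ℕ → ℕ
bound G k = (order G * (maxDegree G + 1 ∸ k)) / (2 + k)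

-- Grow a set K of vertices certified to be forced by a seed set S, starting from the closed
-- neighbourhood of a vertex of maximum degree. While K ≠ V, connectivity gives an edge from
-- some u ∈ K to a vertex outside K; if u has d neighbours outside K, seeding d ∸ k of them lets
-- u force the rest, and as u also has a neighbour inside K we have d < Δ, which is exactly what
-- preserves (k + 2)|S| ≤ (Δ + 1 − k)|K|. When K = V this gives the bound.
-- For tightness, Z_k(Kₙ) = n − k, and for n = k + 3 with k ≥ 2 the bound is ⌊3(k + 3)/(k + 2)⌋ = 3.

module Submission where

open import Defs hiding (sym)
open import Data.Bool using (Bool; true; false; T; T?; _∧_; _∨_; not; if_then_else_)
open import Data.Bool.Properties using (T-∧; T-∨; T-≡; ∧-zeroʳ; ∧-identityʳ)
open import Data.Bool.ListAction using (any)
open import Data.Empty using (⊥-elim)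
open import Data.Fin using (Fin; zero; suc)
open import Data.Fin.Properties using (_≟_)
open import Data.List using (List; []; _∷_; allFin; foldr)
open import Data.List.Properties using (map-tabulate)
open import Data.List.Membership.Propositional using (_∈_)
open import Data.List.Membership.Propositional.Properties using (∈-allFin)
open import Data.List.Relation.Unary.Any using (here; there; satisfied)
import Data.List.Relation.Unary.Any as Any
open import Data.List.Relation.Unary.Any.Properties using (any⁺; any⁻)
open import Data.Nat using (ℕ; zero; suc; _+_; _*_; _∸_; _≤_; _<_; _⊔_; _≤?_; z≤n; s≤s; NonZero)
open import Data.Nat.DivMod using (_/_; m*n/n≡m; /-monoˡ-≤; m<n*o⇒m/o<n)
open import Data.Nat.ListAction using (sum)
open import Data.Nat.Properties hiding (_≟_)
open import Data.Nat.Tactic.RingSolver using (solve-∀)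
open import Data.Product using (Σ; ∃; ∃₂; _×_; _,_; proj₁; proj₂)
open import Data.Sum using (_⊎_; inj₁; inj₂)
import Data.Vec.Functional as Vector
open import Function using (_∘_; Equivalence)
open import Relation.Binary.PropositionalEquality
open import Relation.Nullary using (¬_; does; yes; no)
open import Relation.Nullary.Decidable using (dec-true; dec-false)
open import Algebra.Properties.CommutativeSemigroup +-commutativeSemigroup using (interchange)
open Equivalence using (to; from)

private variable
  m : ℕ

infixr 7 _∩_
infixr 6 _∪_ _∖_
infix 4 _⊆_

_∪_ _∩_ _∖_ : (Fin m → Bool) → (Fin m → Bool) → Fin m → Bool
(p ∪ q) i = p i ∨ q i
(p ∩ q) i = p i ∧ q i
(p ∖ q) i = p i ∧ not (q i)

_⊆_ : (Fin m → Bool) → (Fin m → Bool) → Set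
p ⊆ q = ∀ i → T (p i) → T (q i)

⊆-trans : {p q r : Fin m → Bool} → p ⊆ q → q ⊆ r → p ⊆ r
⊆-trans p⊆q q⊆r i = q⊆r i ∘ p⊆q i

¬T⇒T-not : ∀ {b} → ¬ T b → T (not b)
¬T⇒T-not {false} _ = _
¬T⇒T-not {true} ¬b = ¬b _

T-not⇒¬T : ∀ {b} → T (not b) → ¬ T b
T-not⇒¬T {false} _ ()

⁅_⁆ : Fin m → Fin m → Bool
⁅ v ⁆ w = does (v ≟ w)

⁅⁆-self : (v : Fin m) → T (⁅ v ⁆ v)
⁅⁆-self v = from T-≡ (dec-true (v ≟ v) refl)

⁅⁆⇒≡ : {v w : Fin m} → T (⁅ v ⁆ w) → v ≡ w
⁅⁆⇒≡ {v = v} {w} _ with v ≟ w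
... | yes v≡w = v≡w

⁅⁆-sym : (u v : Fin m) → ⁅ u ⁆ v ≡ ⁅ v ⁆ u
⁅⁆-sym u v with u ≟ v | v ≟ u
... | yes _   | yes _   = refl
... | no _    | no _    = refl
... | yes u≡v | no v≢u  = ⊥-elim (v≢u (sym u≡v))
... | no u≢v  | yes v≡u = ⊥-elim (u≢v (sym v≡u))

indicator : Bool → ℕ
indicator b = if b then 1 else 0

count-suc : (p : Fin (suc m) → Bool) → count p ≡ indicator (p zero) + count (p ∘ suc)
count-suc p = cong (λ xs → indicator (p zero) + sum xs)
  (trans (map-tabulate suc (indicator ∘ p)) (sym (map-tabulate (λ i → i) (indicator ∘ p ∘ suc))))

count-const-false : count {m} (λ _ → false) ≡ 0
count-const-false {zero} = refl
count-const-false {suc m} = trans (count-suc {m} (λ _ → false)) (count-const-false {m})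

count-const-true : count {m} (λ _ → true) ≡ m
count-const-true {zero} = refl
count-const-true {suc m} = trans (count-suc {m} (λ _ → true)) (cong suc (count-const-true {m}))

count-mono : {p q : Fin m → Bool} → p ⊆ q → count p ≤ count q
count-mono {zero} _ = z≤n
count-mono {suc m} {p} {q} p⊆q rewrite count-suc p | count-suc q =
  +-mono-≤ (head (p zero) (q zero) (p⊆q zero)) (count-mono (p⊆q ∘ suc))
  where
  head : ∀ a b → (T a → T b) → indicator a ≤ indicator b
  head false _ _ = z≤n
  head true true _ = ≤-refl
  head true false a⇒b = ⊥-elim (a⇒b _)

count-cong : {p q : Fin m → Bool} → (∀ i → p i ≡ q i) → count p ≡ count q
count-cong p≗q = ≤-antisym (count-mono λ i → subst T (p≗q i)) (count-mono λ i → subst T (sym (p≗q i)))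

count-≤-size : (p : Fin m → Bool) → count p ≤ m
count-≤-size {m} p = ≤-trans (count-mono {m} {q = λ _ → true} λ _ _ → _) (≤-reflexive (count-const-true {m}))

count-partition : (p q : Fin m → Bool) → count p ≡ count (p ∖ q) + count (p ∩ q)
count-partition {zero} p q = refl
count-partition {suc m} p q = begin
    count p
  ≡⟨ count-suc p ⟩
    indicator (p zero) + count (p ∘ suc)
  ≡⟨ cong₂ _+_ (head (p zero) (q zero)) (count-partition (p ∘ suc) (q ∘ suc)) ⟩
    (indicator ((p ∖ q) zero) + indicator ((p ∩ q) zero)) + (count ((p ∖ q) ∘ suc) + count ((p ∩ q) ∘ suc))
  ≡⟨ interchange (indicator ((p ∖ q) zero)) (indicator ((p ∩ q) zero)) (count ((p ∖ q) ∘ suc)) _ ⟩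
    (indicator ((p ∖ q) zero) + count ((p ∖ q) ∘ suc)) + (indicator ((p ∩ q) zero) + count ((p ∩ q) ∘ suc))
  ≡⟨ cong₂ _+_ (count-suc (p ∖ q)) (count-suc (p ∩ q)) ⟨
    count (p ∖ q) + count (p ∩ q)
  ∎
  where
  open ≡-Reasoning
  head : ∀ a b → indicator a ≡ indicator (a ∧ not b) + indicator (a ∧ b)
  head false _ = refl
  head true false = refl
  head true true = refl

count-complement : (p : Fin m → Bool) → count (not ∘ p) + count p ≡ m
count-complement {m} p = trans (sym (count-partition (λ _ → true) p)) (count-const-true {m})

count-∪ : (p q : Fin m → Bool) → count (p ∪ q) ≡ count p + count (q ∖ p)
count-∪ p q = begin
    count (p ∪ q)
  ≡⟨ count-partition (p ∪ q) p ⟩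
    count ((p ∪ q) ∖ p) + count ((p ∪ q) ∩ p)
  ≡⟨ +-comm (count ((p ∪ q) ∖ p)) _ ⟩
    count ((p ∪ q) ∩ p) + count ((p ∪ q) ∖ p)
  ≡⟨ cong₂ _+_ (count-cong λ i → absorb (p i) (q i)) (count-cong λ i → shift (p i) (q i)) ⟩
    count p + count (q ∖ p)
  ∎
  where
  open ≡-Reasoning
  absorb : ∀ a b → (a ∨ b) ∧ a ≡ a
  absorb false b = ∧-zeroʳ b
  absorb true _ = refl
  shift : ∀ a b → (a ∨ b) ∧ not a ≡ b ∧ not a
  shift false b = refl
  shift true b = sym (∧-zeroʳ b)

count-∪-≤ : (p q : Fin m → Bool) → count (p ∪ q) ≤ count p + count q
count-∪-≤ p q = ≤-trans (≤-reflexive (count-∪ p q))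
  (+-monoʳ-≤ (count p) (count-mono {q = q} λ i q∖p → proj₁ (to T-∧ q∖p)))

count-∖-⊆ : {p q : Fin m → Bool} → q ⊆ p → count (p ∖ q) + count q ≡ count p
count-∖-⊆ {p = p} {q} q⊆p = trans
  (cong (count (p ∖ q) +_) (count-cong {p = q} λ i → sym (meet (p i) (q i) (q⊆p i))))
  (sym (count-partition p q))
  where
  meet : ∀ a b → (T b → T a) → a ∧ b ≡ b
  meet _ false _ = ∧-zeroʳ _
  meet true true _ = refl
  meet false true b⇒a = ⊥-elim (b⇒a _)

count-⁅⁆ : (v : Fin m) → count ⁅ v ⁆ ≡ 1
count-⁅⁆ {suc m} zero = trans (count-suc {m} ⁅ zero ⁆) (cong suc (count-const-false {m}))
count-⁅⁆ {suc m} (suc v) = trans (count-suc {m} ⁅ suc v ⁆) (count-⁅⁆ v)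

count-positive : (p : Fin m → Bool) (i : Fin m) → T (p i) → 0 < count p
count-positive p i pi = ≤-trans (≤-reflexive (sym (count-⁅⁆ i))) (count-mono ⁅i⁆⊆p)
  where
  ⁅i⁆⊆p : ⁅ i ⁆ ⊆ p
  ⁅i⁆⊆p j i≡j with i ≟ j
  ... | yes refl = pi

count-witness : (p : Fin m → Bool) → 0 < count p → ∃ λ i → T (p i)
count-witness {suc m} p pos rewrite count-suc p with p zero in p0
... | true = zero , from T-≡ p0
... | false with i , pi ← count-witness (p ∘ suc) pos = suc i , pi

count-full : (p : Fin m → Bool) → m ≤ count p → ∀ i → T (p i)
count-full p full i with T? (p i)
... | yes pi = pi
... | no ¬pi = ⊥-elim (<-irrefl refl (begin-strict
    count p                   <⟨ +-monoˡ-≤ (count p) (count-positive (not ∘ p) i (¬T⇒T-not ¬pi)) ⟩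
    count (not ∘ p) + count p ≡⟨ count-complement p ⟩
    _                         ≤⟨ full ⟩
    count p                   ∎))
  where open ≤-Reasoning

count-not-full : (p : Fin m → Bool) → count p < m → ∃ λ i → ¬ T (p i)
count-not-full p lt with count (not ∘ p) in c | count-complement p
... | zero | c+|p|≡m = ⊥-elim (<-irrefl c+|p|≡m lt)
... | suc _ | _ with i , pi ← count-witness (not ∘ p) (subst (0 <_) (sym c) (s≤s z≤n)) = i , T-not⇒¬T pi

subset-of-size : (p : Fin m → Bool) (j : ℕ) → j ≤ count p →
  Σ (Fin m → Bool) λ A → A ⊆ p × count A ≡ j
subset-of-size {zero} p zero _ = (λ ()) , (λ ()) , refl
subset-of-size {suc m} p j j≤ rewrite count-suc p with p zero in p0 | j
... | true | zero = (λ _ → false) , (λ _ ()) , count-const-false {suc m}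
... | true | suc j with A , A⊆ , |A| ← subset-of-size (p ∘ suc) j (≤-pred j≤) =
  true Vector.∷ A ,
  (λ { zero _ → from T-≡ p0 ; (suc i) → A⊆ i }) ,
  trans (count-suc (true Vector.∷ A)) (cong suc |A|)
... | false | j with A , A⊆ , |A| ← subset-of-size (p ∘ suc) j j≤ =
  false Vector.∷ A ,
  (λ { zero () ; (suc i) → A⊆ i }) ,
  trans (count-suc (false Vector.∷ A)) |A|

maxOf : ∀ {a} {A : Set a} → (A → ℕ) → List A → ℕ
maxOf f = foldr (λ x m → f x ⊔ m) 0

module _ {a} {A : Set a} (f : A → ℕ) where

  ≤-maxOf : ∀ {x xs} → x ∈ xs → f x ≤ maxOf f xs
  ≤-maxOf (here refl) = m≤m⊔n _ _
  ≤-maxOf {xs = y ∷ _} (there x∈xs) = ≤-trans (≤-maxOf x∈xs) (m≤n⊔m (f y) _)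

  maxOf-lub : ∀ {c} xs → (∀ x → f x ≤ c) → maxOf f xs ≤ c
  maxOf-lub [] _ = z≤n
  maxOf-lub (x ∷ xs) f≤c = ⊔-lub (f≤c x) (maxOf-lub xs f≤c)

  maxOf-attained : ∀ xs → 0 < maxOf f xs → ∃ λ x → f x ≡ maxOf f xs
  maxOf-attained (x ∷ xs) pos with ⊔-sel (f x) (maxOf f xs)
  ... | inj₁ fx = x , sym fx
  ... | inj₂ rest with y , fy ← maxOf-attained xs (subst (0 <_) rest pos) = y , trans fy (sym rest)

degree≤maxDegree : (G : Graph) (v : Fin (n G)) → degree G v ≤ maxDegree G
degree≤maxDegree G v = ≤-maxOf (degree G) (∈-allFin v)

maxDegree-lub : (G : Graph) {c : ℕ} → (∀ v → degree G v ≤ c) → maxDegree G ≤ c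
maxDegree-lub G = maxOf-lub (degree G) (allFin (n G))

maxDegree-attained : (G : Graph) → 0 < maxDegree G → ∃ λ v → degree G v ≡ maxDegree G
maxDegree-attained G = maxOf-attained (degree G) (allFin (n G))

walk-exit : (G : Graph) (K : VSet G) {u w : Fin (n G)} → Walk G u w → T (K u) → ¬ T (K w) →
  ∃₂ λ x y → T (adj G x y) × T (K x) × ¬ T (K y)
walk-exit G K here Ku ¬Kw = ⊥-elim (¬Kw Ku)
walk-exit G K (step {v = v} uv walk) Ku ¬Kw with T? (K v)
... | yes Kv = walk-exit G K walk Kv ¬Kw
... | no ¬Kv = _ , v , from T-≡ uv , Ku , ¬Kv

any-allFin⁺ : (f : Fin m → Bool) (i : Fin m) → T (f i) → T (any f (allFin m))
any-allFin⁺ f i fi = any⁺ f (Any.map (λ { refl → fi }) (∈-allFin i))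

-- The forcing process

module _ (G : Graph) (k : ℕ) where

  active-sound : ∀ F v → T (active G k F v) → T (F v) × outside G F v ≤ k
  active-sound F v act with outside G F v
  ... | suc o with F v
  ...   | true = _ , ≤ᵇ⇒≤ (suc o) k act

  active-complete : ∀ F v → T (F v) → 0 < outside G F v → outside G F v ≤ k → T (active G k F v)
  active-complete F v Fv pos le with outside G F v
  ... | suc o with F v
  ...   | true = ≤⇒≤ᵇ le

  forceStep-inflationary : ∀ F → F ⊆ forceStep G k F
  forceStep-inflationary F w Fw = from T-∨ (inj₁ Fw)

  forceStep-elim : ∀ F w → T (forceStep G k F w) →
    T (F w) ⊎ ∃ λ v → T (active G k F v) × T (adj G v w)
  forceStep-elim F w forced with to T-∨ forced
  ... | inj₁ Fw = inj₁ Fw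
  ... | inj₂ some with v , act∧vw ← satisfied (any⁻ _ (allFin (n G)) some) = inj₂ (v , to T-∧ act∧vw)

  neighbours-forced : ∀ F u → T (F u) → outside G F u ≤ k → adj G u ⊆ forceStep G k F
  neighbours-forced F u Fu le w uw with T? (F w)
  ... | yes Fw = forceStep-inflationary F w Fw
  ... | no ¬Fw = from T-∨ (inj₂ (any-allFin⁺ _ u (from T-∧ (active-complete F u Fu pos le , uw))))
    where
    pos : 0 < outside G F u
    pos = count-positive (adj G u ∖ F) w (from T-∧ (uw , ¬T⇒T-not ¬Fw))

  outside-antitone : ∀ {F F'} v → F ⊆ F' → outside G F' v ≤ outside G F v
  outside-antitone {F} {F'} v F⊆F' = count-mono {p = adj G v ∖ F'} λ w vw∖F' → case (to T-∧ vw∖F')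
    where
    case : ∀ {w} → T (adj G v w) × T (not (F' w)) → T (adj G v w ∧ not (F w))
    case {w} (vw , ¬F'w) = from T-∧ (vw , ¬T⇒T-not λ Fw → T-not⇒¬T ¬F'w (F⊆F' w Fw))

  forceStep-monotone : ∀ {F F'} → F ⊆ F' → forceStep G k F ⊆ forceStep G k F'
  forceStep-monotone {F} {F'} F⊆F' w forced with forceStep-elim F w forced
  ... | inj₁ Fw = forceStep-inflationary F' w (F⊆F' w Fw)
  ... | inj₂ (v , act , vw) with Fv , le ← active-sound F v act =
    neighbours-forced F' v (F⊆F' v Fv) (≤-trans (outside-antitone v F⊆F') le) w vw

  closure-monotone : ∀ {S S'} → S ⊆ S' → ∀ t → closure G k S t ⊆ closure G k S' t
  closure-monotone S⊆S' zero = S⊆S'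
  closure-monotone S⊆S' (suc t) = forceStep-monotone (closure-monotone S⊆S' t)

  closure-inflationary : ∀ S t → S ⊆ closure G k S t
  closure-inflationary S zero w Sw = Sw
  closure-inflationary S (suc t) w Sw =
    forceStep-inflationary (closure G k S t) w (closure-inflationary S t w Sw)

  forceStep-⊆ : ∀ F → (∀ v → T (F v) → k < outside G F v) → forceStep G k F ⊆ F
  forceStep-⊆ F stuck w forced with forceStep-elim F w forced
  ... | inj₁ Fw = Fw
  ... | inj₂ (v , act , _) with Fv , le ← active-sound F v act = ⊥-elim (<⇒≱ (stuck v Fv) le)

  closure-⊆ : ∀ F → forceStep G k F ⊆ F → ∀ t → closure G k F t ⊆ F
  closure-⊆ F closed zero w Fw = Fw
  closure-⊆ F closed (suc t) w forced = closed w (forceStep-monotone (closure-⊆ F closed t) w forced)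

-- The greedy construction

x+[m∸k]≡m⇒x≤k : ∀ {x m k} → x + (m ∸ k) ≡ m → x ≤ k
x+[m∸k]≡m⇒x≤k {x} {m} {k} eq =
  +-cancelʳ-≤ (m ∸ k) x k (subst (_≤ k + (m ∸ k)) (sym eq) (m≤n+m∸n m k))

*≤⇒≤/ : ∀ {x y} d .{{_ : NonZero d}} → x * d ≤ y → x ≤ y / d
*≤⇒≤/ {x} d le = ≤-trans (≤-reflexive (sym (m*n/n≡m x d))) (/-monoˡ-≤ d le)

step-weight : ∀ k m D → m < D → (2 + k) * (m ∸ k) ≤ (D + 1 ∸ k) * m
step-weight k m D m<D with m ≤? k
... | yes m≤k rewrite m≤n⇒m∸n≡0 m≤k | *-zeroʳ (2 + k) = z≤n
... | no m≰k = begin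
    (2 + k) * j                    ≤⟨ m≤m+n _ (2 * k + j * j) ⟩
    (2 + k) * j + (2 * k + j * j)  ≡⟨ expand k j ⟩
    (2 + j) * (k + j)              ≡⟨ cong₂ _*_ (sym (+-∸-assoc 2 k≤m)) (m+[n∸m]≡n k≤m) ⟩
    (2 + m ∸ k) * m                ≤⟨ *-monoˡ-≤ m (∸-monoˡ-≤ k (≤-trans (s≤s m<D) (≤-reflexive (+-comm 1 D)))) ⟩
    (D + 1 ∸ k) * m                ∎
  where
  open ≤-Reasoning
  j = m ∸ k
  k≤m : k ≤ m
  k≤m = <⇒≤ (≰⇒> m≰k)
  expand : ∀ k j → (2 + k) * j + (2 * k + j * j) ≡ (2 + j) * (k + j)
  expand = solve-∀

start-weight : ∀ k D → k < D → (2 + k) * (1 + (D ∸ k)) ≤ (D + 1 ∸ k) * (1 + D)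
start-weight k D k<D = begin
  (2 + k) * (1 + (D ∸ k))  ≡⟨ cong ((2 + k) *_) (sym (+-∸-assoc 1 (<⇒≤ k<D))) ⟩
  (2 + k) * (1 + D ∸ k)    ≡⟨ cong (λ x → (2 + k) * (x ∸ k)) (+-comm 1 D) ⟩
  (2 + k) * (D + 1 ∸ k)    ≤⟨ *-monoˡ-≤ (D + 1 ∸ k) (s≤s k<D) ⟩
  (1 + D) * (D + 1 ∸ k)    ≡⟨ *-comm (1 + D) _ ⟩
  (D + 1 ∸ k) * (1 + D)    ∎
  where open ≤-Reasoning

module Greedy (G : Graph) (k : ℕ) where

  Δ : ℕ
  Δ = maxDegree G

  extend-by-neighbourhood : ∀ {S K t} u → K ⊆ closure G k S t → T (K u) →
    Σ (VSet G) λ S' → count S' ≤ count S + (count (adj G u ∖ K) ∸ k)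
                    × K ∪ adj G u ⊆ closure G k S' (suc t)
  extend-by-neighbourhood {S} {K} {t} u K⊆ Ku = S ∪ A , |S∪A| , K∪N⊆
    where
    new = adj G u ∖ K
    chosen = subset-of-size new (count new ∸ k) (m∸n≤m _ k)
    A = proj₁ chosen
    A⊆new = proj₁ (proj₂ chosen)
    |A| = proj₂ (proj₂ chosen)
    F = closure G k (S ∪ A) t
    |S∪A| : count (S ∪ A) ≤ count S + (count new ∸ k)
    |S∪A| = subst (λ a → count (S ∪ A) ≤ count S + a) |A| (count-∪-≤ S A)
    K⊆F : K ⊆ F
    K⊆F = ⊆-trans K⊆ (closure-monotone G k (λ w Sw → from T-∨ (inj₁ Sw)) t)
    A⊆F : A ⊆ F
    A⊆F = ⊆-trans (λ w Aw → from T-∨ (inj₂ Aw)) (closure-inflationary G k (S ∪ A) t)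
    unforced⊆ : adj G u ∖ F ⊆ new ∖ A
    unforced⊆ w uw∖F with uw , ¬Fw ← to T-∧ uw∖F =
      from T-∧ (from T-∧ (uw , ¬T⇒T-not (T-not⇒¬T ¬Fw ∘ K⊆F w)) , ¬T⇒T-not (T-not⇒¬T ¬Fw ∘ A⊆F w))
    unforced : outside G F u ≤ k
    unforced = ≤-trans (count-mono {p = adj G u ∖ F} unforced⊆)
      (x+[m∸k]≡m⇒x≤k (subst (λ a → count (new ∖ A) + a ≡ count new) |A| (count-∖-⊆ A⊆new)))
    K∪N⊆ : K ∪ adj G u ⊆ forceStep G k F
    K∪N⊆ w K∪N with to T-∨ K∪N
    ... | inj₁ Kw = forceStep-inflationary G k F w (K⊆F w Kw)
    ... | inj₂ uw = neighbours-forced G k F u (K⊆F u Ku) unforced w uw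

  HasNeighbourIn : VSet G → Fin (n G) → Set
  HasNeighbourIn K v = ∃ λ w → T (adj G v w) × T (K w)

  ∪-adj-no-isolated : ∀ K u → T (K u) → (∀ v → T (K v) → HasNeighbourIn (K ∪ adj G u) v) →
    ∀ v → T ((K ∪ adj G u) v) → HasNeighbourIn (K ∪ adj G u) v
  ∪-adj-no-isolated K u Ku old v K∪N with to T-∨ K∪N
  ... | inj₁ Kv = old v Kv
  ... | inj₂ uv = u , subst T (Graph.sym G u v) uv , from T-∨ (inj₁ Ku)

  record Progress (S K : VSet G) : Set where
    field
      time        : ℕ
      covered     : K ⊆ closure G k S time
      inhabited   : ∃ λ v → T (K v)
      no-isolated : ∀ v → T (K v) → HasNeighbourIn K v
      weight      : (2 + k) * count S ≤ (Δ + 1 ∸ k) * count K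

  unknown-neighbours<Δ : ∀ K u → HasNeighbourIn K u → count (adj G u ∖ K) < Δ
  unknown-neighbours<Δ K u (w , uw , Kw) = begin-strict
    count (adj G u ∖ K)                         <⟨ m<m+n _ (count-positive (adj G u ∩ K) w (from T-∧ (uw , Kw))) ⟩
    count (adj G u ∖ K) + count (adj G u ∩ K)   ≡⟨ count-partition (adj G u) K ⟨
    degree G u                                  ≤⟨ degree≤maxDegree G u ⟩
    Δ                                           ∎
    where open ≤-Reasoning

  grow : ∀ {S K u y} → Progress S K → T (adj G u y) → T (K u) → ¬ T (K y) →
    Σ (VSet G) λ S' → Σ (VSet G) λ K' → Progress S' K' × count K < count K'
  grow {S} {K} {u} {y} P uy Ku ¬Ky = S' , K' , progress , larger
    where
    open Progress P
    c = Δ + 1 ∸ k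
    new = count (adj G u ∖ K)
    ext = extend-by-neighbourhood {t = time} u covered Ku
    S' = proj₁ ext
    K' = K ∪ adj G u
    |K'| : count K' ≡ count K + new
    |K'| = count-∪ K (adj G u)
    weight' : (2 + k) * count S' ≤ c * count K'
    weight' = begin
      (2 + k) * count S'                       ≤⟨ *-monoʳ-≤ (2 + k) (proj₁ (proj₂ ext)) ⟩
      (2 + k) * (count S + (new ∸ k))          ≡⟨ *-distribˡ-+ (2 + k) (count S) _ ⟩
      (2 + k) * count S + (2 + k) * (new ∸ k)  ≤⟨ +-mono-≤ weight (step-weight k new Δ new<Δ) ⟩
      c * count K + c * new                    ≡⟨ *-distribˡ-+ c (count K) new ⟨
      c * (count K + new)                      ≡⟨ cong (c *_) |K'| ⟨
      c * count K'                             ∎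
      where
      open ≤-Reasoning
      new<Δ = unknown-neighbours<Δ K u (no-isolated u Ku)
    widen : ∀ {v} → HasNeighbourIn K v → HasNeighbourIn K' v
    widen (w , vw , Kw) = w , vw , from T-∨ (inj₁ Kw)
    progress : Progress S' K'
    progress = record
      { time        = suc time
      ; covered     = proj₂ (proj₂ ext)
      ; inhabited   = u , from T-∨ (inj₁ Ku)
      ; no-isolated = ∪-adj-no-isolated K u Ku (λ v → widen ∘ no-isolated v)
      ; weight      = weight'
      }
    larger : count K < count K'
    larger = subst (count K <_) (sym |K'|)
      (m<m+n _ (count-positive (adj G u ∖ K) y (from T-∧ (uy , ¬T⇒T-not ¬Ky))))

  adj∖self : ∀ v w → (adj G v ∖ ⁅ v ⁆) w ≡ adj G v w
  adj∖self v w with v ≟ w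
  ... | yes refl = trans (∧-zeroʳ (adj G v v)) (sym (irrefl G v))
  ... | no _ = ∧-identityʳ (adj G v w)

  start : k < Δ → Σ (VSet G) λ S → Σ (VSet G) λ K → Progress S K
  start k<Δ = S' , K' , progress
    where
    c = Δ + 1 ∸ k
    0<Δ = ≤-trans (s≤s z≤n) k<Δ
    top = maxDegree-attained G 0<Δ
    v₀ = proj₁ top
    v₀∈⁅v₀⁆ : T (⁅ v₀ ⁆ v₀)
    v₀∈⁅v₀⁆ = ⁅⁆-self v₀
    ext = extend-by-neighbourhood {S = ⁅ v₀ ⁆} {t = 0} v₀ (λ _ h → h) v₀∈⁅v₀⁆
    S' = proj₁ ext
    K' = ⁅ v₀ ⁆ ∪ adj G v₀
    m≡Δ : count (adj G v₀ ∖ ⁅ v₀ ⁆) ≡ Δ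
    m≡Δ = trans (count-cong (adj∖self v₀)) (proj₂ top)
    |S'| : count S' ≤ 1 + (Δ ∸ k)
    |S'| = subst₂ (λ a b → count S' ≤ a + (b ∸ k)) (count-⁅⁆ v₀) m≡Δ (proj₁ (proj₂ ext))
    |K'| : count K' ≡ 1 + Δ
    |K'| = trans (count-∪ ⁅ v₀ ⁆ (adj G v₀)) (cong₂ _+_ (count-⁅⁆ v₀) m≡Δ)
    weight : (2 + k) * count S' ≤ c * count K'
    weight = begin
      (2 + k) * count S'      ≤⟨ *-monoʳ-≤ (2 + k) |S'| ⟩
      (2 + k) * (1 + (Δ ∸ k)) ≤⟨ start-weight k Δ k<Δ ⟩
      c * (1 + Δ)             ≡⟨ cong (c *_) |K'| ⟨
      c * count K'            ∎
      where open ≤-Reasoning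
    neighbour : HasNeighbourIn K' v₀
    neighbour with w , v₀w ← count-witness (adj G v₀) (subst (0 <_) (sym (proj₂ top)) 0<Δ) =
      w , v₀w , from T-∨ (inj₂ v₀w)
    progress : Progress S' K'
    progress = record
      { time        = 1
      ; covered     = proj₂ (proj₂ ext)
      ; inhabited   = v₀ , from T-∨ (inj₁ v₀∈⁅v₀⁆)
      ; no-isolated = ∪-adj-no-isolated ⁅ v₀ ⁆ v₀ v₀∈⁅v₀⁆
                        λ v v₀≡v → subst (HasNeighbourIn K') (⁅⁆⇒≡ v₀≡v) neighbour
      ; weight      = weight
      }

  saturate : Connected G → ∀ fuel {S K} → Progress S K → n G ≤ count K + fuel →
    Σ (VSet G) λ S → IsForcingSet G k S × (2 + k) * count S ≤ (Δ + 1 ∸ k) * n G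
  saturate conn fuel {S} {K} P enough with n G ≤? count K
  ... | yes full = S , (time , λ w → to T-≡ (covered w (count-full K full w))) ,
                   ≤-trans weight (*-monoʳ-≤ (Δ + 1 ∸ k) (count-≤-size K))
    where open Progress P
  ... | no ¬full
    with w , ¬Kw ← count-not-full K (≰⇒> ¬full)
    with v , Kv ← Progress.inhabited P
    with x , y , xy , Kx , ¬Ky ← walk-exit G K (conn v w) Kv ¬Kw
    with fuel
  ... | zero = ⊥-elim (¬full (subst (n G ≤_) (+-identityʳ (count K)) enough))
  ... | suc fuel with S' , K' , P' , larger ← grow P xy Kx ¬Ky =
    saturate conn fuel P'
      (≤-trans enough (≤-trans (≤-reflexive (+-suc (count K) fuel)) (+-monoˡ-≤ fuel larger)))

  small-forcing-set : Connected G → k < Δ →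
    Σ (VSet G) λ S → IsForcingSet G k S × (2 + k) * count S ≤ (Δ + 1 ∸ k) * n G
  small-forcing-set conn k<Δ with S , K , P ← start k<Δ =
    saturate conn (n G) P (m≤n+m (n G) (count K))

Zk≤bound : (G : Graph) (k : ℕ) → Connected G → k < maxDegree G → ∀ z → IsZk G k z → z ≤ bound G k
Zk≤bound G k conn k<Δ z (_ , minimal) with S , forcing , weight ← Greedy.small-forcing-set G k conn k<Δ =
  ≤-trans (minimal S forcing) (*≤⇒≤/ (2 + k) (begin
    count S * (2 + k)                         ≡⟨ *-comm (count S) (2 + k) ⟩
    (2 + k) * count S                         ≤⟨ weight ⟩
    (maxDegree G + 1 ∸ k) * n G               ≡⟨ *-comm _ (n G) ⟩
    order G * (maxDegree G + 1 ∸ k)           ∎))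
  where open ≤-Reasoning

-- Complete graphs

complete : ℕ → Graph
complete m = record
  { n      = m
  ; adj    = λ u v → not (⁅ u ⁆ v)
  ; sym    = λ u v → cong not (⁅⁆-sym u v)
  ; irrefl = λ v → cong not (dec-true (v ≟ v) refl)
  }

complete-connected : Connected (complete m)
complete-connected u v with u ≟ v
... | yes refl = here
... | no u≢v = step (cong not (dec-false (u ≟ v) u≢v)) here

complete-degree : (v : Fin (suc m)) → degree (complete (suc m)) v ≡ m
complete-degree {m} v = +-cancelʳ-≡ 1 _ m (begin
  degree (complete (suc m)) v + 1              ≡⟨ cong (degree (complete (suc m)) v +_) (count-⁅⁆ v) ⟨
  count (not ∘ ⁅ v ⁆) + count ⁅ v ⁆            ≡⟨ count-complement ⁅ v ⁆ ⟩
  suc m                                        ≡⟨ +-comm 1 m ⟩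
  m + 1                                        ∎)
  where open ≡-Reasoning

complete-maxDegree : maxDegree (complete (suc m)) ≡ m
complete-maxDegree {m} = ≤-antisym
  (maxDegree-lub (complete (suc m)) (≤-reflexive ∘ complete-degree))
  (≤-trans (≤-reflexive (sym (complete-degree zero))) (degree≤maxDegree (complete (suc m)) zero))

complete-outside : (F : Fin m → Bool) (v : Fin m) → T (F v) → outside (complete m) F v ≡ count (not ∘ F)
complete-outside F v Fv = count-cong pointwise
  where
  pointwise : ∀ w → not (⁅ v ⁆ w) ∧ not (F w) ≡ not (F w)
  pointwise w with v ≟ w
  ... | no _ = refl
  ... | yes refl rewrite to T-≡ Fv = refl

x+y≡m⇒y<m∸k⇒k<x : ∀ {x y m k} → x + y ≡ m → y < m ∸ k → k < x
x+y≡m⇒y<m∸k⇒k<x {x} {y} {k = k} refl y<m∸k = ≰⇒> λ x≤k → <⇒≱ y<m∸k (begin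
  x + y ∸ k ≤⟨ ∸-monoˡ-≤ k (+-monoˡ-≤ y x≤k) ⟩
  k + y ∸ k ≡⟨ m+n∸m≡n k y ⟩
  y         ∎)
  where open ≤-Reasoning

-- Any n ∸ k vertices of Kₙ force in one step; in a smaller set every vertex has more than k
-- neighbours outside it, so nothing is ever forced.
Zk-complete : ∀ {m k} → k < m → IsZk (complete m) k (m ∸ k)
Zk-complete {m} {k} k<m = (S , forcing , |S|) , minimal
  where
  G = complete m
  chosen = subset-of-size {m} (λ _ → true) (m ∸ k) (subst (m ∸ k ≤_) (sym (count-const-true {m})) (m∸n≤m m k))
  S = proj₁ chosen
  |S| = proj₂ (proj₂ chosen)
  seed = count-witness S (subst (0 <_) (sym |S|) (m<n⇒0<n∸m k<m))
  v = proj₁ seed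
  Sv = proj₂ seed
  unforced : outside G S v ≤ k
  unforced = ≤-trans (≤-reflexive (complete-outside S v Sv))
    (x+[m∸k]≡m⇒x≤k (subst (λ a → count (not ∘ S) + a ≡ m) |S| (count-complement S)))
  forcing : IsForcingSet G k S
  forcing = 1 , λ w → to T-≡ (forced w)
    where
    forced : ∀ w → T (forceStep G k S w)
    forced w with T? (S w)
    ... | yes Sw = forceStep-inflationary G k S w Sw
    ... | no ¬Sw = neighbours-forced G k S v Sv unforced w
                     (¬T⇒T-not λ v≡w → ¬Sw (subst (T ∘ S) (⁅⁆⇒≡ v≡w) Sv))
  minimal : ∀ S' → IsForcingSet G k S' → m ∸ k ≤ count S'
  minimal S' (t , all) with m ∸ k ≤? count S'
  ... | yes large = large
  ... | no ¬large = ⊥-elim (<⇒≱ small (≤-trans (m∸n≤m m k) everything))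
    where
    small : count S' < m ∸ k
    small = ≰⇒> ¬large
    stalled : forceStep G k S' ⊆ S'
    stalled = forceStep-⊆ G k S' λ u S'u →
      subst (k <_) (sym (complete-outside S' u S'u)) (x+y≡m⇒y<m∸k⇒k<x (count-complement S') small)
    everything : m ≤ count S'
    everything = ≤-trans (≤-reflexive (sym (count-const-true {m})))
      (count-mono {p = λ _ → true} λ w _ → closure-⊆ G k S' stalled t w (from T-≡ (all w)))

complete-bound : ∀ k → 2 ≤ k → bound (complete (3 + k)) k ≡ 3
complete-bound k 2≤k = begin
    (3 + k) * (maxDegree (complete (3 + k)) + 1 ∸ k) / (2 + k)
  ≡⟨ cong (λ d → (3 + k) * (d + 1 ∸ k) / (2 + k)) (complete-maxDegree {2 + k}) ⟩
    (3 + k) * (2 + k + 1 ∸ k) / (2 + k)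
  ≡⟨ cong (λ c → (3 + k) * c / (2 + k)) three ⟩
    (3 + k) * 3 / (2 + k)
  ≡⟨ ≤-antisym (≤-pred (m<n*o⇒m/o<n {o = 2 + k} below)) (*≤⇒≤/ (2 + k) above) ⟩
    3
  ∎
  where
  open ≡-Reasoning
  three : 2 + k + 1 ∸ k ≡ 3
  three = trans (cong (_∸ k) (+-comm (2 + k) 1)) (m+n∸n≡m 3 k)
  below : (3 + k) * 3 < 4 * (2 + k)
  below = ≤-trans (≤-reflexive (e₁ k)) (≤-trans (+-monoʳ-≤ (8 + 3 * k) 2≤k) (≤-reflexive (e₂ k)))
    where
    e₁ : ∀ k → suc ((3 + k) * 3) ≡ 8 + 3 * k + 2
    e₁ = solve-∀
    e₂ : ∀ k → 8 + 3 * k + k ≡ 4 * (2 + k)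
    e₂ = solve-∀
  above : 3 * (2 + k) ≤ (3 + k) * 3
  above = ≤-trans (m≤m+n (3 * (2 + k)) 3) (≤-reflexive (e k))
    where
    e : ∀ k → 3 * (2 + k) + 3 ≡ (3 + k) * 3
    e = solve-∀

corollary5p6 :
    ((k : ℕ) (G : Graph) → Connected G → k + 2 ≤ maxDegree G →
      ∀ m → IsZk G k m → m ≤ bound G k)
    × ((k : ℕ) → 2 ≤ k →
      Σ Graph λ G → Connected G × k + 2 ≤ maxDegree G × IsZk G k (bound G k))
corollary5p6 = upper , tight
  where
  upper : (k : ℕ) (G : Graph) → Connected G → k + 2 ≤ maxDegree G → ∀ z → IsZk G k z → z ≤ bound G k
  upper k G conn k+2≤Δ = Zk≤bound G k conn (<-≤-trans (m<m+n k (s≤s z≤n)) k+2≤Δ)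
  tight : (k : ℕ) → 2 ≤ k → Σ Graph λ G → Connected G × k + 2 ≤ maxDegree G × IsZk G k (bound G k)
  tight k 2≤k = complete (3 + k) , complete-connected ,
    ≤-reflexive (trans (+-comm k 2) (sym (complete-maxDegree {2 + k}))) ,
    subst (IsZk (complete (3 + k)) k) (trans (m+n∸n≡m 3 k) (sym (complete-bound k 2≤k)))
      (Zk-complete (m<n+m k (s≤s z≤n)))
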